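{- Let $n\ge1$, let $w_0$ be an integer and $w_1,w_2$ nonzero integers. Let $T\subseteq[n]$ have cardinality $t\le n/2$, and let $\overline{T}=[n]\setminus T$. Define $f(x_1,\dots,x_n)=\mathrm{sgn}\big(w_0+w_1\sum_{u\in T}x_u+w_2\sum_{v\in\overline{T}}x_v\big)$. Then $$W^{(0)}[f]=\frac{1}{2^{2n}}\Big[\sum_{(i,j)\in\mathcal{S}_0}\binom{t}{i}\binom{n-t}{j}\Big]^2,$$ $$W^{(1)}[f]=\frac{t}{2^{2n-2}}\Big[\sum_{(i,j)\in\mathcal{S}_1}\binom{t-1}{i}\binom{n-t}{j}\Big]^2+\frac{n-t}{2^{2n-2}}\Big[\sum_{(i,j)\in\mathcal{S}_2}\binom{t}{i}\binom{n-t-1}{j}\Big]^2,$$ where: if $w_0\ge0$, $\mathcal{S}_0=\{(i,j):0\le i\le t,\ 0\le j\le n-t,\ -w_0\le w_1(2i-t)+w_2(2j-(n-t))\le w_0\}$; if $w_0<0$, $\mathcal{S}_0=\{(i,j):0\le i\le t,\ 0\le j\le n-t,\ w_0< w_1(2i-t)+w_2(2j-(n-t))< -w_0\}$; $\mathcal{S}_1=\{(i,j):0\le i\le t-1,\ 0\le j\le n-t,\ -|w_1|\le w_0+w_1(2i-(t-1))+w_2(2j-(n-t))<|w_1|\}$; $\mathcal{S}_2=\{(i,j):0\le i\le t,\ 0\le j\le n-t-1,\ -|w_2|\le w_0+w_1(2i-t)+w_2(2j-(n-t-1))<|w_2|\}$.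
   Context: $\mathrm{sgn}(z)=1$ if $z\ge0$ and $-1$ if $z<0$. The Fourier coefficients of $f:\{ -1,1\}^n\to\{ -1,1\}$ are $\hat f(S)=2^{ -n}\sum_{\mathbf{x}\in\{ -1,1\}^n} f(\mathbf{x})\prod_{i\in S}x_i$ for $S\subseteq[n]$, and $W^{(k)}[f]=\sum_{S\subseteq[n],|S|=k}\hat f(S)^2$. -}

module Defs where

open import Data.Bool using (Bool; true; false; if_then_else_; _∧_)
open import Data.Nat as ℕ using (ℕ; zero; suc; _^_)
open import Data.Nat.Properties using (m^n≢0)
open import Data.Integer as ℤ using (ℤ; +_; -[1+_]; _≤ᵇ_)
open import Data.Rational as ℚ using (ℚ)
open import Data.List using (List; []; _∷_; map; _++_; filter; foldr; upTo; concatMap)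
open import Data.Vec using (Vec; []; _∷_)
open import Data.Fin.Subset using (Subset; ∣_∣)
open import Relation.Nullary using (does)
open import Relation.Binary.PropositionalEquality using (_≡_)

_<ᵇ_ : ℤ → ℤ → Bool
infix 4 _<ᵇ_
a <ᵇ b = (a ℤ.+ + 1) ≤ᵇ b

sgn : ℤ → ℤ
sgn z = if (+ 0) ≤ᵇ z then + 1 else -[1+ 0 ]

cube : (n : ℕ) → List (Vec ℤ n)
cube zero = [] ∷ []
cube (suc n) = map (+ 1 ∷_) (cube n) ++ map (-[1+ 0 ] ∷_) (cube n)

allSubsets : (n : ℕ) → List (Subset n)
allSubsets zero = [] ∷ []
allSubsets (suc n) = map (true ∷_) (allSubsets n) ++ map (false ∷_) (allSubsets n)

sumℤ : List ℤ → ℤ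
sumℤ = foldr ℤ._+_ (+ 0)

sumℚ : List ℚ → ℚ
sumℚ = foldr ℚ._+_ ℚ.0ℚ

chi : ∀ {n} → Subset n → Vec ℤ n → ℤ
chi [] [] = + 1
chi (true ∷ S) (x ∷ xs) = x ℤ.* chi S xs
chi (false ∷ S) (x ∷ xs) = chi S xs

sumIn : ∀ {n} → Subset n → Vec ℤ n → ℤ
sumIn [] [] = + 0
sumIn (true ∷ T) (x ∷ xs) = x ℤ.+ sumIn T xs
sumIn (false ∷ T) (x ∷ xs) = sumIn T xs

sumOut : ∀ {n} → Subset n → Vec ℤ n → ℤ
sumOut [] [] = + 0
sumOut (true ∷ T) (x ∷ xs) = sumOut T xs
sumOut (false ∷ T) (x ∷ xs) = x ℤ.+ sumOut T xs

divPow2 : ℤ → ℕ → ℚ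
divPow2 z k = ℚ._/_ z (2 ^ k) {{m^n≢0 2 k}}

fourier : ∀ {n} → (Vec ℤ n → ℤ) → Subset n → ℚ
fourier {n} f S = divPow2 (sumℤ (map (λ x → f x ℤ.* chi S x) (cube n))) n

W : ∀ {n} → ℕ → (Vec ℤ n → ℤ) → ℚ
W {n} k f = sumℚ (map (λ S → fourier f S ℚ.* fourier f S)
                      (filter (λ S → ∣ S ∣ ℕ.≟ k) (allSubsets n)))

thr : ∀ {n} → ℤ → ℤ → ℤ → Subset n → Vec ℤ n → ℤ
thr w₀ w₁ w₂ T x = sgn (w₀ ℤ.+ w₁ ℤ.* sumIn T x ℤ.+ w₂ ℤ.* sumOut T x)

sumPairs : ℕ → ℕ → (ℕ → ℕ → Bool) → (ℕ → ℕ → ℕ) → ℕ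
sumPairs a b P g = foldr ℕ._+_ 0
  (concatMap (λ i → map (λ j → if P i j then g i j else 0) (upTo b)) (upTo a))

twice-minus : ℕ → ℤ → ℤ
twice-minus k m = + (2 ℕ.* k) ℤ.- m

∣_∣ℤ : ℤ → ℤ
∣ z ∣ℤ = + (ℤ.∣ z ∣)

-- Membership in S₀ (i ≤ t, j ≤ n - t handled by the ranges in sumPairs)
inS₀ : ℤ → ℤ → ℤ → ℕ → ℕ → ℕ → ℕ → Bool
inS₀ w₀ w₁ w₂ n t i j =
  if (+ 0) ≤ᵇ w₀ then (ℤ.- w₀ ≤ᵇ v) ∧ (v ≤ᵇ w₀) else (w₀ <ᵇ v) ∧ (v <ᵇ ℤ.- w₀)
  where v = w₁ ℤ.* twice-minus i (+ t) ℤ.+ w₂ ℤ.* twice-minus j (+ (n ℕ.∸ t))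

inS₁ : ℤ → ℤ → ℤ → ℕ → ℕ → ℕ → ℕ → Bool
inS₁ w₀ w₁ w₂ n t i j = (ℤ.- ∣ w₁ ∣ℤ ≤ᵇ v) ∧ (v <ᵇ ∣ w₁ ∣ℤ)
  where v = w₀ ℤ.+ w₁ ℤ.* twice-minus i (+ t ℤ.- + 1) ℤ.+ w₂ ℤ.* twice-minus j (+ (n ℕ.∸ t))

inS₂ : ℤ → ℤ → ℤ → ℕ → ℕ → ℕ → ℕ → Bool
inS₂ w₀ w₁ w₂ n t i j = (ℤ.- ∣ w₂ ∣ℤ ≤ᵇ v) ∧ (v <ᵇ ∣ w₂ ∣ℤ)
  where v = w₀ ℤ.+ w₁ ℤ.* twice-minus i (+ t) ℤ.+ w₂ ℤ.* twice-minus j (+ (n ℕ.∸ t) ℤ.- + 1)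

module Submission where

-- On {-1,1}ⁿ the threshold function depends only on the block sums a = Σ_{u∈T} x_u and
-- b = Σ_{v∉T} x_v, which take the values 2i - t and 2j - (n - t) on C(t,i)·C(n-t,j) points.
-- So 2ⁿ f̂(∅) is a double binomial sum of sgn (w₀ + w₁ a + w₂ b); averaging it with its image
-- under (a, b) ↦ (-a, -b) gives the summand sgn (w₀ + v) + sgn (w₀ - v), which is 2 sgn w₀ on
-- S₀ and 0 off it. For k ∈ T, splitting x_k = ±1 writes 2ⁿ f̂({k}) as a double binomial sum over
-- the other t - 1 and n - t coordinates of sgn (u + w₁) - sgn (u - w₁), which is 2 sgn w₁ on S₁
-- and 0 off it; k ∉ T is symmetric, with w₂ and S₂.

open import Defs
open import Algebra.Bundles using (CommutativeMonoid)
open import Data.Bool using (Bool; true; false; if_then_else_; _∧_; not; T)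
open import Data.Fin using (Fin; zero; suc)
open import Data.Fin.Subset using (Subset; ∣_∣; ∁; ⊥; ⁅_⁆)
open import Data.Fin.Subset.Properties using (∣∁p∣≡n∸∣p∣; ∣p∣≤n)
open import Data.Integer as ℤ using (ℤ; +_; -[1+_]; -1ℤ; _+_; _*_; -_; _-_; _≤ᵇ_)
import Data.Integer.Properties as ℤ
open import Data.Integer.Tactic.RingSolver using (solve-∀)
open import Data.List as List using (List; map; _++_)
open import Data.List.Properties using (map-++; map-∘; map-tabulate; filter-++; filter-none; filter-≐)
open import Data.List.Relation.Unary.All using (universal)
open import Data.Nat as ℕ using (ℕ; zero; suc; _∸_; s≤s; _≤_; NonZero; _^_)
import Data.Nat.Properties as ℕ
open import Data.Nat.Combinatorics using (_C_; k>n⇒nCk≡0; nCk+nC[k+1]≡[n+1]C[k+1]; nCk≡nC[n∸k])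
open import Data.Nat.ListAction using () renaming (sum to sumℕ)
open import Data.Nat.ListAction.Properties using (sum-++)
open import Data.Product using (_×_; _,_)
open import Data.Rational as ℚ using (ℚ)
import Data.Rational.Properties as ℚ
open import Data.Rational.Unnormalised as ℚᵘ using (mkℚᵘ; *≡*)
import Data.Rational.Unnormalised.Properties as ℚᵘ
open import Data.Unit using (tt)
open import Data.Vec using (Vec; []; _∷_; lookup; insertAt; removeAt)
open import Data.Vec.Properties using (insertAt-lookup; insertAt-removeAt)
open import Function using (_∘_; _⇔_; mk⇔; Equivalence)
open import Relation.Nullary using (¬_; contradiction; ¬?; does; Dec)
open import Relation.Nullary.Decidable using (does-⇔; T?)
open import Relation.Unary using (Decidable)
open import Relation.Binary.PropositionalEquality
open ≡-Reasoning

open import Algebra.Properties.CommutativeSemigroup ℤ.+-commutativeSemigroup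
  using () renaming (interchange to +-interchange; x∙yz≈y∙xz to +-swap)
open import Algebra.Properties.CommutativeSemigroup
  (CommutativeMonoid.commutativeSemigroup ℚ.+-0-commutativeMonoid)
  using () renaming (x∙yz≈y∙xz to ℚ-+-swap)

-- Binomial sums

∑< : ℕ → (ℕ → ℤ) → ℤ
∑< zero    f = + 0
∑< (suc k) f = f 0 + ∑< k (λ i → f (suc i))

syntax ∑< k (λ i → e) = ∑[ i < k ] e

∑-cong : ∀ k {f g : ℕ → ℤ} → (∀ i → i ℕ.< k → f i ≡ g i) → ∑[ i < k ] f i ≡ ∑[ i < k ] g i
∑-cong zero    f≗g = refl
∑-cong (suc k) f≗g = cong₂ _+_ (f≗g 0 ℕ.z<s) (∑-cong k (λ i i<k → f≗g (suc i) (s≤s i<k)))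

∑-+ : ∀ k (f g : ℕ → ℤ) → ∑[ i < k ] (f i + g i) ≡ ∑[ i < k ] f i + ∑[ i < k ] g i
∑-+ zero    f g = refl
∑-+ (suc k) f g = begin
  (f 0 + g 0) + ∑[ i < k ] (f (suc i) + g (suc i))
    ≡⟨ cong (_+_ (f 0 + g 0)) (∑-+ k (λ i → f (suc i)) (λ i → g (suc i))) ⟩
  (f 0 + g 0) + (∑[ i < k ] f (suc i) + ∑[ i < k ] g (suc i))
    ≡⟨ +-interchange (f 0) (g 0) _ _ ⟩
  (f 0 + ∑[ i < k ] f (suc i)) + (g 0 + ∑[ i < k ] g (suc i)) ∎

∑-* : ∀ k c (f : ℕ → ℤ) → ∑[ i < k ] (c * f i) ≡ c * ∑[ i < k ] f i
∑-* zero    c f = sym (ℤ.*-zeroʳ c)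
∑-* (suc k) c f =
  trans (cong (_+_ (c * f 0)) (∑-* k c (λ i → f (suc i)))) (sym (ℤ.*-distribˡ-+ c (f 0) _))

∑-snoc : ∀ k (f : ℕ → ℤ) → ∑[ i < suc k ] f i ≡ ∑[ i < k ] f i + f k
∑-snoc zero    f = trans (ℤ.+-identityʳ (f 0)) (sym (ℤ.+-identityˡ (f 0)))
∑-snoc (suc k) f =
  trans (cong (_+_ (f 0)) (∑-snoc k (λ i → f (suc i)))) (sym (ℤ.+-assoc (f 0) _ _))

∑-reverse : ∀ k (f : ℕ → ℤ) → ∑[ i < suc k ] f i ≡ ∑[ i < suc k ] f (k ∸ i)
∑-reverse zero    f = refl
∑-reverse (suc k) f = begin
  ∑[ i < suc (suc k) ] f i                  ≡⟨ ∑-snoc (suc k) f ⟩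
  ∑[ i < suc k ] f i + f (suc k)            ≡⟨ cong (_+ f (suc k)) (∑-reverse k f) ⟩
  ∑[ i < suc k ] f (k ∸ i) + f (suc k)      ≡⟨ ℤ.+-comm _ (f (suc k)) ⟩
  f (suc k) + ∑[ i < suc k ] f (k ∸ i)      ∎

-- The sum of h (x₁ + ⋯ + x_t) over x ∈ {-1,1}ᵗ, grouped by the number i of entries +1.
binomialSum : ℕ → (ℤ → ℤ) → ℤ
binomialSum t h = ∑[ i < suc t ] (+ (t C i) * h (twice-minus i (+ t)))

binomialSum-zero : ∀ h → binomialSum 0 h ≡ h (+ 0)
binomialSum-zero h = trans (ℤ.+-identityʳ (+ 1 * h (+ 0))) (ℤ.*-identityˡ (h (+ 0)))

binomialSum-cong : ∀ t {g h : ℤ → ℤ} → (∀ a → g a ≡ h a) → binomialSum t g ≡ binomialSum t h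
binomialSum-cong t g≗h = ∑-cong (suc t) (λ i _ → cong (+ (t C i) *_) (g≗h (twice-minus i (+ t))))

binomialSum-+ : ∀ t (g h : ℤ → ℤ) → binomialSum t (λ a → g a + h a) ≡ binomialSum t g + binomialSum t h
binomialSum-+ t g h = trans
  (∑-cong (suc t) (λ i _ → ℤ.*-distribˡ-+ (+ (t C i)) (g (twice-minus i (+ t))) (h (twice-minus i (+ t)))))
  (∑-+ (suc t) (λ i → + (t C i) * g (twice-minus i (+ t))) (λ i → + (t C i) * h (twice-minus i (+ t))))

binomialSum-* : ∀ t c (h : ℤ → ℤ) → binomialSum t (λ a → c * h a) ≡ c * binomialSum t h
binomialSum-* t c h = trans
  (∑-cong (suc t) (λ i _ → *-swap (+ (t C i)) c (h (twice-minus i (+ t)))))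
  (∑-* (suc t) c (λ i → + (t C i) * h (twice-minus i (+ t))))
  where
  *-swap : ∀ a b c → a * (b * c) ≡ b * (a * c)
  *-swap = solve-∀

twice-minus-suc : ∀ i t → twice-minus i (+ suc t) ≡ -1ℤ + twice-minus i (+ t)
twice-minus-suc i t = shift (+ (2 ℕ.* i)) (+ t)
  where
  shift : ∀ a b → a - (+ 1 + b) ≡ -1ℤ + (a - b)
  shift = solve-∀

twice-minus-suc-suc : ∀ i t → twice-minus (suc i) (+ suc t) ≡ + 1 + twice-minus i (+ t)
twice-minus-suc-suc i t = begin
  + (2 ℕ.* suc i) - (+ 1 + + t)        ≡⟨ cong (λ z → + z - (+ 1 + + t)) (ℕ.*-suc 2 i) ⟩
  + (2 ℕ.+ 2 ℕ.* i) - (+ 1 + + t)      ≡⟨ shift (+ (2 ℕ.* i)) (+ t) ⟩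
  + 1 + (+ (2 ℕ.* i) - + t)            ∎
  where
  shift : ∀ a b → (+ 2 + a) - (+ 1 + b) ≡ + 1 + (a - b)
  shift = solve-∀

twice-minus-reflect : ∀ {i t} → i ℕ.≤ t → twice-minus (t ∸ i) (+ t) ≡ - twice-minus i (+ t)
twice-minus-reflect {i} {t} i≤t = begin
  + (2 ℕ.* r) - + t                        ≡⟨ cong (λ s → + (2 ℕ.* r) - + s) t≡i+r ⟩
  + (2 ℕ.* r) - + (i ℕ.+ r)                ≡⟨ cong₂ _-_ (ℤ.pos-* 2 r) (ℤ.pos-+ i r) ⟩
  + 2 * + r - (+ i + + r)                  ≡⟨ reflect (+ i) (+ r) ⟩
  - (+ 2 * + i - (+ i + + r))              ≡⟨ cong₂ (λ a b → - (a - b)) (ℤ.pos-* 2 i) (ℤ.pos-+ i r) ⟨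
  - (+ (2 ℕ.* i) - + (i ℕ.+ r))            ≡⟨ cong (λ s → - (+ (2 ℕ.* i) - + s)) t≡i+r ⟨
  - (+ (2 ℕ.* i) - + t)                    ∎
  where
  r = t ∸ i
  t≡i+r : t ≡ i ℕ.+ r
  t≡i+r = sym (ℕ.m+[n∸m]≡n i≤t)
  reflect : ∀ a b → + 2 * b - (a + b) ≡ - (+ 2 * a - (a + b))
  reflect = solve-∀

binomialSum-suc : ∀ t (h : ℤ → ℤ) →
  binomialSum (suc t) h ≡ binomialSum t (λ a → h (+ 1 + a)) + binomialSum t (λ a → h (-1ℤ + a))
binomialSum-suc t h = begin
  h₀ + ∑[ i < suc t ] (+ (suc t C suc i) * h (x (suc i)))
    ≡⟨ cong (_+_ h₀) (trans (∑-cong (suc t) pascal) (∑-+ (suc t) (λ i → + (t C i) * h (x (suc i)))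
                                                                (λ i → + (t C suc i) * h (x (suc i))))) ⟩
  h₀ + (A + B)          ≡⟨ +-swap h₀ A B ⟩
  A + (h₀ + B)          ≡⟨ cong₂ _+_ upper lower ⟩
  binomialSum t (λ a → h (+ 1 + a)) + binomialSum t (λ a → h (-1ℤ + a)) ∎
  where
  x : ℕ → ℤ
  x i = twice-minus i (+ suc t)
  h₀ = + 1 * h (x 0)
  A = ∑[ i < suc t ] (+ (t C i) * h (x (suc i)))
  B = ∑[ i < suc t ] (+ (t C suc i) * h (x (suc i)))
  pascal : ∀ i → i ℕ.< suc t →
    + (suc t C suc i) * h (x (suc i)) ≡ + (t C i) * h (x (suc i)) + + (t C suc i) * h (x (suc i))
  pascal i _ = begin
    + (suc t C suc i) * h (x (suc i))           ≡⟨ cong (λ c → + c * h (x (suc i))) (nCk+nC[k+1]≡[n+1]C[k+1] t i) ⟨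
    + (t C i ℕ.+ t C suc i) * h (x (suc i))     ≡⟨ cong (_* h (x (suc i))) (ℤ.pos-+ (t C i) (t C suc i)) ⟩
    (+ (t C i) + + (t C suc i)) * h (x (suc i)) ≡⟨ ℤ.*-distribʳ-+ (h (x (suc i))) (+ (t C i)) (+ (t C suc i)) ⟩
    + (t C i) * h (x (suc i)) + + (t C suc i) * h (x (suc i)) ∎
  upper : A ≡ binomialSum t (λ a → h (+ 1 + a))
  upper = ∑-cong (suc t) (λ i _ → cong (λ a → + (t C i) * h a) (twice-minus-suc-suc i t))
  lower : h₀ + B ≡ binomialSum t (λ a → h (-1ℤ + a))
  lower = begin
    ∑[ i < suc (suc t) ] (+ (t C i) * h (x i))
      ≡⟨ ∑-snoc (suc t) (λ i → + (t C i) * h (x i)) ⟩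
    ∑[ i < suc t ] (+ (t C i) * h (x i)) + + (t C suc t) * h (x (suc t))
      ≡⟨ cong (λ c → ∑[ i < suc t ] (+ (t C i) * h (x i)) + + c * h (x (suc t))) (k>n⇒nCk≡0 (ℕ.n<1+n t)) ⟩
    ∑[ i < suc t ] (+ (t C i) * h (x i)) + + 0
      ≡⟨ ℤ.+-identityʳ _ ⟩
    ∑[ i < suc t ] (+ (t C i) * h (x i))
      ≡⟨ ∑-cong (suc t) (λ i _ → cong (λ a → + (t C i) * h a) (twice-minus-suc i t)) ⟩
    binomialSum t (λ a → h (-1ℤ + a)) ∎

binomialSum-neg : ∀ t (h : ℤ → ℤ) → binomialSum t h ≡ binomialSum t (λ a → h (- a))
binomialSum-neg t h = trans (∑-reverse t (λ i → + (t C i) * h (twice-minus i (+ t)))) (∑-cong (suc t) reflect)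
  where
  reflect : ∀ i → i ℕ.< suc t →
    + (t C (t ∸ i)) * h (twice-minus (t ∸ i) (+ t)) ≡ + (t C i) * h (- twice-minus i (+ t))
  reflect i i<1+t = cong₂ (λ c a → + c * h a) (sym (nCk≡nC[n∸k] i≤t)) (twice-minus-reflect i≤t)
    where i≤t = ℕ.≤-pred i<1+t

binomialSum₂ : ℕ → ℕ → (ℤ → ℤ → ℤ) → ℤ
binomialSum₂ t m g = binomialSum t (λ a → binomialSum m (g a))

binomialSum₂-cong : ∀ t m {g h : ℤ → ℤ → ℤ} → (∀ a b → g a b ≡ h a b) →
  binomialSum₂ t m g ≡ binomialSum₂ t m h
binomialSum₂-cong t m g≗h = binomialSum-cong t (λ a → binomialSum-cong m (g≗h a))

binomialSum₂-+ : ∀ t m (g h : ℤ → ℤ → ℤ) →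
  binomialSum₂ t m (λ a b → g a b + h a b) ≡ binomialSum₂ t m g + binomialSum₂ t m h
binomialSum₂-+ t m g h = trans
  (binomialSum-cong t (λ a → binomialSum-+ m (g a) (h a)))
  (binomialSum-+ t (λ a → binomialSum m (g a)) (λ a → binomialSum m (h a)))

binomialSum₂-* : ∀ t m c (g : ℤ → ℤ → ℤ) →
  binomialSum₂ t m (λ a b → c * g a b) ≡ c * binomialSum₂ t m g
binomialSum₂-* t m c g = trans
  (binomialSum-cong t (λ a → binomialSum-* m c (g a)))
  (binomialSum-* t c (λ a → binomialSum m (g a)))

binomialSum₂-*-* : ∀ t m c d (g : ℤ → ℤ → ℤ) →
  binomialSum₂ t m (λ a b → c * (d * g a b)) ≡ c * (d * binomialSum₂ t m g)
binomialSum₂-*-* t m c d g = trans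
  (binomialSum₂-* t m c (λ a b → d * g a b))
  (cong (c *_) (binomialSum₂-* t m d g))

binomialSum₂-neg : ∀ t m (g : ℤ → ℤ → ℤ) →
  binomialSum₂ t m g ≡ binomialSum₂ t m (λ a b → g (- a) (- b))
binomialSum₂-neg t m g = trans
  (binomialSum-neg t (λ a → binomialSum m (g a)))
  (binomialSum-cong t (λ a → binomialSum-neg m (g (- a))))

indicator : Bool → ℤ
indicator true  = + 1
indicator false = + 0

∑-applyUpTo : ∀ (h : ℕ → ℕ) b f → + sumℕ (map h (List.applyUpTo f b)) ≡ ∑[ j < b ] (+ h (f j))
∑-applyUpTo h zero    f = refl
∑-applyUpTo h (suc b) f = trans (ℤ.pos-+ (h (f 0)) _) (cong (_+_ (+ h (f 0))) (∑-applyUpTo h b (f ∘ suc)))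

∑-concatMap : ∀ (H : ℕ → List ℕ) a f →
  + sumℕ (List.concatMap H (List.applyUpTo f a)) ≡ ∑[ i < a ] (+ sumℕ (H (f i)))
∑-concatMap H zero    f = refl
∑-concatMap H (suc a) f = begin
  + sumℕ (H (f 0) ++ List.concatMap H (List.applyUpTo (f ∘ suc) a))
    ≡⟨ cong +_ (sum-++ (H (f 0)) _) ⟩
  + (sumℕ (H (f 0)) ℕ.+ sumℕ (List.concatMap H (List.applyUpTo (f ∘ suc) a)))
    ≡⟨ ℤ.pos-+ (sumℕ (H (f 0))) _ ⟩
  + sumℕ (H (f 0)) + + sumℕ (List.concatMap H (List.applyUpTo (f ∘ suc) a))
    ≡⟨ cong (_+_ (+ sumℕ (H (f 0)))) (∑-concatMap H a (f ∘ suc)) ⟩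
  ∑[ i < suc a ] (+ sumℕ (H (f i))) ∎

sumPairs-binomialSum₂ : ∀ t m (P : ℤ → ℤ → Bool) →
  + sumPairs (suc t) (suc m) (λ i j → P (twice-minus i (+ t)) (twice-minus j (+ m))) (λ i j → (t C i) ℕ.* (m C j))
  ≡ binomialSum₂ t m (λ a b → indicator (P a b))
sumPairs-binomialSum₂ t m P = begin
  _ ≡⟨ ∑-concatMap (λ i → map (term i) (List.upTo (suc m))) (suc t) (λ i → i) ⟩
  ∑[ i < suc t ] (+ sumℕ (map (term i) (List.upTo (suc m))))
    ≡⟨ ∑-cong (suc t) (λ i _ → ∑-applyUpTo (term i) (suc m) (λ j → j)) ⟩
  ∑[ i < suc t ] (∑[ j < suc m ] (+ term i j))
    ≡⟨ ∑-cong (suc t) (λ i _ → ∑-cong (suc m) (λ j _ → split (t C i) (m C j) (P (x i) (y j)))) ⟩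
  ∑[ i < suc t ] (∑[ j < suc m ] (+ (t C i) * (+ (m C j) * indicator (P (x i) (y j)))))
    ≡⟨ ∑-cong (suc t) (λ i _ → ∑-* (suc m) (+ (t C i)) (λ j → + (m C j) * indicator (P (x i) (y j)))) ⟩
  binomialSum₂ t m (λ a b → indicator (P a b)) ∎
  where
  x y : ℕ → ℤ
  x i = twice-minus i (+ t)
  y j = twice-minus j (+ m)
  term : ℕ → ℕ → ℕ
  term i j = if P (x i) (y j) then (t C i) ℕ.* (m C j) else 0
  split : ∀ c d b → + (if b then c ℕ.* d else 0) ≡ + c * (+ d * indicator b)
  split c d true  = trans (ℤ.pos-* c d) (cong (+ c *_) (sym (ℤ.*-identityʳ (+ d))))
  split c d false = sym (trans (cong (+ c *_) (ℤ.*-zeroʳ (+ d))) (ℤ.*-zeroʳ (+ c)))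

-- Sums over the cube

cubeSum : ∀ n → (Vec ℤ n → ℤ) → ℤ
cubeSum zero    F = F []
cubeSum (suc n) F = cubeSum n (λ x → F (+ 1 ∷ x)) + cubeSum n (λ x → F (-1ℤ ∷ x))

sumℤ-++ : ∀ (xs ys : List ℤ) → sumℤ (xs ++ ys) ≡ sumℤ xs + sumℤ ys
sumℤ-++ List.[]       ys = sym (ℤ.+-identityˡ (sumℤ ys))
sumℤ-++ (x List.∷ xs) ys = trans (cong (_+_ x) (sumℤ-++ xs ys)) (sym (ℤ.+-assoc x (sumℤ xs) (sumℤ ys)))

sum-map-cube : ∀ n (F : Vec ℤ n → ℤ) → sumℤ (map F (cube n)) ≡ cubeSum n F
sum-map-cube zero    F = ℤ.+-identityʳ (F [])
sum-map-cube (suc n) F = begin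
  sumℤ (map F (map (+ 1 ∷_) (cube n) ++ map (-1ℤ ∷_) (cube n)))
    ≡⟨ cong sumℤ (map-++ F (map (+ 1 ∷_) (cube n)) (map (-1ℤ ∷_) (cube n))) ⟩
  sumℤ (map F (map (+ 1 ∷_) (cube n)) ++ map F (map (-1ℤ ∷_) (cube n)))
    ≡⟨ sumℤ-++ (map F (map (+ 1 ∷_) (cube n))) (map F (map (-1ℤ ∷_) (cube n))) ⟩
  sumℤ (map F (map (+ 1 ∷_) (cube n))) + sumℤ (map F (map (-1ℤ ∷_) (cube n)))
    ≡⟨ cong₂ (λ xs ys → sumℤ xs + sumℤ ys) (map-∘ (cube n)) (map-∘ (cube n)) ⟨
  sumℤ (map (λ x → F (+ 1 ∷ x)) (cube n)) + sumℤ (map (λ x → F (-1ℤ ∷ x)) (cube n))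
    ≡⟨ cong₂ _+_ (sum-map-cube n (λ x → F (+ 1 ∷ x))) (sum-map-cube n (λ x → F (-1ℤ ∷ x))) ⟩
  cubeSum (suc n) F ∎

cubeSum-cong : ∀ n {F G : Vec ℤ n → ℤ} → (∀ x → F x ≡ G x) → cubeSum n F ≡ cubeSum n G
cubeSum-cong zero    F≗G = F≗G []
cubeSum-cong (suc n) F≗G =
  cong₂ _+_ (cubeSum-cong n (λ x → F≗G (+ 1 ∷ x))) (cubeSum-cong n (λ x → F≗G (-1ℤ ∷ x)))

cubeSum-+ : ∀ n (F G : Vec ℤ n → ℤ) → cubeSum n (λ x → F x + G x) ≡ cubeSum n F + cubeSum n G
cubeSum-+ zero    F G = refl
cubeSum-+ (suc n) F G = begin
  cubeSum n (λ x → F (+ 1 ∷ x) + G (+ 1 ∷ x)) + cubeSum n (λ x → F (-1ℤ ∷ x) + G (-1ℤ ∷ x))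
    ≡⟨ cong₂ _+_ (cubeSum-+ n (λ x → F (+ 1 ∷ x)) (λ x → G (+ 1 ∷ x)))
                 (cubeSum-+ n (λ x → F (-1ℤ ∷ x)) (λ x → G (-1ℤ ∷ x))) ⟩
  (cubeSum n (λ x → F (+ 1 ∷ x)) + cubeSum n (λ x → G (+ 1 ∷ x)))
    + (cubeSum n (λ x → F (-1ℤ ∷ x)) + cubeSum n (λ x → G (-1ℤ ∷ x)))
    ≡⟨ +-interchange (cubeSum n (λ x → F (+ 1 ∷ x))) (cubeSum n (λ x → G (+ 1 ∷ x)))
                     (cubeSum n (λ x → F (-1ℤ ∷ x))) (cubeSum n (λ x → G (-1ℤ ∷ x))) ⟩
  cubeSum (suc n) F + cubeSum (suc n) G ∎

cubeSum-insertAt : ∀ n (k : Fin (suc n)) (F : Vec ℤ (suc n) → ℤ) →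
  cubeSum (suc n) F ≡ cubeSum n (λ y → F (insertAt y k (+ 1))) + cubeSum n (λ y → F (insertAt y k -1ℤ))
cubeSum-insertAt n       zero    F = refl
cubeSum-insertAt (suc n) (suc k) F = begin
  cubeSum (suc n) (λ x → F (+ 1 ∷ x)) + cubeSum (suc n) (λ x → F (-1ℤ ∷ x))
    ≡⟨ cong₂ _+_ (cubeSum-insertAt n k (λ x → F (+ 1 ∷ x))) (cubeSum-insertAt n k (λ x → F (-1ℤ ∷ x))) ⟩
  (A (+ 1) (+ 1) + A (+ 1) -1ℤ) + (A -1ℤ (+ 1) + A -1ℤ -1ℤ)
    ≡⟨ +-interchange (A (+ 1) (+ 1)) (A (+ 1) -1ℤ) (A -1ℤ (+ 1)) (A -1ℤ -1ℤ) ⟩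
  cubeSum (suc n) (λ y → F (insertAt y (suc k) (+ 1))) + cubeSum (suc n) (λ y → F (insertAt y (suc k) -1ℤ)) ∎
  where
  A : ℤ → ℤ → ℤ
  A e e′ = cubeSum n (λ y → F (e ∷ insertAt y k e′))

cubeSum-blocks : ∀ {n} (T : Subset n) (g : ℤ → ℤ → ℤ) →
  cubeSum n (λ x → g (sumIn T x) (sumOut T x)) ≡ binomialSum₂ ∣ T ∣ ∣ ∁ T ∣ g
cubeSum-blocks []          g = sym (trans (binomialSum-zero (λ a → binomialSum 0 (g a))) (binomialSum-zero (g (+ 0))))
cubeSum-blocks (true ∷ T)  g = begin
  cubeSum _ (λ x → g (+ 1 + sumIn T x) (sumOut T x)) + cubeSum _ (λ x → g (-1ℤ + sumIn T x) (sumOut T x))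
    ≡⟨ cong₂ _+_ (cubeSum-blocks T (λ a → g (+ 1 + a))) (cubeSum-blocks T (λ a → g (-1ℤ + a))) ⟩
  binomialSum₂ t m (λ a → g (+ 1 + a)) + binomialSum₂ t m (λ a → g (-1ℤ + a))
    ≡⟨ binomialSum-suc t (λ a → binomialSum m (g a)) ⟨
  binomialSum₂ (suc t) m g ∎
  where
  t = ∣ T ∣
  m = ∣ ∁ T ∣
cubeSum-blocks (false ∷ T) g = begin
  cubeSum _ (λ x → g (sumIn T x) (+ 1 + sumOut T x)) + cubeSum _ (λ x → g (sumIn T x) (-1ℤ + sumOut T x))
    ≡⟨ cong₂ _+_ (cubeSum-blocks T (λ a b → g a (+ 1 + b))) (cubeSum-blocks T (λ a b → g a (-1ℤ + b))) ⟩
  binomialSum₂ t m (λ a b → g a (+ 1 + b)) + binomialSum₂ t m (λ a b → g a (-1ℤ + b))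
    ≡⟨ binomialSum-+ t (λ a → binomialSum m (λ b → g a (+ 1 + b)))
                       (λ a → binomialSum m (λ b → g a (-1ℤ + b))) ⟨
  binomialSum t (λ a → binomialSum m (λ b → g a (+ 1 + b)) + binomialSum m (λ b → g a (-1ℤ + b)))
    ≡⟨ binomialSum-cong t (λ a → sym (binomialSum-suc m (g a))) ⟩
  binomialSum₂ t (suc m) g ∎
  where
  t = ∣ T ∣
  m = ∣ ∁ T ∣

sumIn-insertAt : ∀ {n} (T : Subset n) k b (x : Vec ℤ n) e →
  sumIn (insertAt T k b) (insertAt x k e) ≡ sumIn (b ∷ T) (e ∷ x)
sumIn-insertAt T           zero    b     x       e = refl
sumIn-insertAt (true ∷ T)  (suc k) true  (y ∷ x) e =
  trans (cong (_+_ y) (sumIn-insertAt T k true x e)) (+-swap y e (sumIn T x))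
sumIn-insertAt (true ∷ T)  (suc k) false (y ∷ x) e = cong (_+_ y) (sumIn-insertAt T k false x e)
sumIn-insertAt (false ∷ T) (suc k) true  (y ∷ x) e = sumIn-insertAt T k true x e
sumIn-insertAt (false ∷ T) (suc k) false (y ∷ x) e = sumIn-insertAt T k false x e

sumOut-insertAt : ∀ {n} (T : Subset n) k b (x : Vec ℤ n) e →
  sumOut (insertAt T k b) (insertAt x k e) ≡ sumOut (b ∷ T) (e ∷ x)
sumOut-insertAt T           zero    b     x       e = refl
sumOut-insertAt (false ∷ T) (suc k) false (y ∷ x) e =
  trans (cong (_+_ y) (sumOut-insertAt T k false x e)) (+-swap y e (sumOut T x))
sumOut-insertAt (false ∷ T) (suc k) true  (y ∷ x) e = cong (_+_ y) (sumOut-insertAt T k true x e)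
sumOut-insertAt (true ∷ T)  (suc k) false (y ∷ x) e = sumOut-insertAt T k false x e
sumOut-insertAt (true ∷ T)  (suc k) true  (y ∷ x) e = sumOut-insertAt T k true x e

cubeSum-*-lookup : ∀ n (k : Fin (suc n)) (F : Vec ℤ (suc n) → ℤ) →
  cubeSum (suc n) (λ x → F x * lookup x k) ≡ cubeSum n (λ y → F (insertAt y k (+ 1)) - F (insertAt y k -1ℤ))
cubeSum-*-lookup n k F = begin
  cubeSum (suc n) (λ x → F x * lookup x k)
    ≡⟨ cubeSum-insertAt n k (λ x → F x * lookup x k) ⟩
  cubeSum n (λ y → F (insertAt y k (+ 1)) * lookup (insertAt y k (+ 1)) k)
    + cubeSum n (λ y → F (insertAt y k -1ℤ) * lookup (insertAt y k -1ℤ) k)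
    ≡⟨ cong₂ _+_ (cubeSum-cong n (λ y → cong (F (insertAt y k (+ 1)) *_) (insertAt-lookup y k (+ 1))))
                 (cubeSum-cong n (λ y → cong (F (insertAt y k -1ℤ) *_) (insertAt-lookup y k -1ℤ))) ⟩
  cubeSum n (λ y → F (insertAt y k (+ 1)) * + 1) + cubeSum n (λ y → F (insertAt y k -1ℤ) * -1ℤ)
    ≡⟨ cubeSum-+ n (λ y → F (insertAt y k (+ 1)) * + 1) (λ y → F (insertAt y k -1ℤ) * -1ℤ) ⟨
  cubeSum n (λ y → F (insertAt y k (+ 1)) * + 1 + F (insertAt y k -1ℤ) * -1ℤ)
    ≡⟨ cubeSum-cong n (λ y → ±-difference (F (insertAt y k (+ 1))) (F (insertAt y k -1ℤ))) ⟩
  cubeSum n (λ y → F (insertAt y k (+ 1)) - F (insertAt y k -1ℤ)) ∎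
  where
  ±-difference : ∀ p q → p * + 1 + q * -1ℤ ≡ p - q
  ±-difference = solve-∀

cubeSum-blocks-inside : ∀ {n} (T : Subset n) (k : Fin (suc n)) (g : ℤ → ℤ → ℤ) →
  cubeSum (suc n) (λ x → g (sumIn (insertAt T k true) x) (sumOut (insertAt T k true) x) * lookup x k)
  ≡ binomialSum₂ ∣ T ∣ ∣ ∁ T ∣ (λ a b → g (+ 1 + a) b - g (-1ℤ + a) b)
cubeSum-blocks-inside {n} T k g = begin
  _ ≡⟨ cubeSum-*-lookup n k (λ x → g (sumIn (insertAt T k true) x) (sumOut (insertAt T k true) x)) ⟩
  _ ≡⟨ cubeSum-cong n (λ y → cong₂ _-_ (moved y (+ 1)) (moved y -1ℤ)) ⟩
  cubeSum n (λ y → g (+ 1 + sumIn T y) (sumOut T y) - g (-1ℤ + sumIn T y) (sumOut T y))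
    ≡⟨ cubeSum-blocks T (λ a b → g (+ 1 + a) b - g (-1ℤ + a) b) ⟩
  _ ∎
  where
  moved : ∀ y e → g (sumIn (insertAt T k true) (insertAt y k e)) (sumOut (insertAt T k true) (insertAt y k e))
                  ≡ g (e + sumIn T y) (sumOut T y)
  moved y e = cong₂ g (sumIn-insertAt T k true y e) (sumOut-insertAt T k true y e)

cubeSum-blocks-outside : ∀ {n} (T : Subset n) (k : Fin (suc n)) (g : ℤ → ℤ → ℤ) →
  cubeSum (suc n) (λ x → g (sumIn (insertAt T k false) x) (sumOut (insertAt T k false) x) * lookup x k)
  ≡ binomialSum₂ ∣ T ∣ ∣ ∁ T ∣ (λ a b → g a (+ 1 + b) - g a (-1ℤ + b))
cubeSum-blocks-outside {n} T k g = begin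
  _ ≡⟨ cubeSum-*-lookup n k (λ x → g (sumIn (insertAt T k false) x) (sumOut (insertAt T k false) x)) ⟩
  _ ≡⟨ cubeSum-cong n (λ y → cong₂ _-_ (moved y (+ 1)) (moved y -1ℤ)) ⟩
  cubeSum n (λ y → g (sumIn T y) (+ 1 + sumOut T y) - g (sumIn T y) (-1ℤ + sumOut T y))
    ≡⟨ cubeSum-blocks T (λ a b → g a (+ 1 + b) - g a (-1ℤ + b)) ⟩
  _ ∎
  where
  moved : ∀ y e → g (sumIn (insertAt T k false) (insertAt y k e)) (sumOut (insertAt T k false) (insertAt y k e))
                  ≡ g (sumIn T y) (e + sumOut T y)
  moved y e = cong₂ g (sumIn-insertAt T k false y e) (sumOut-insertAt T k false y e)

-- Sign identities

window₀ : ℤ → ℤ → Bool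
window₀ w₀ v = if + 0 ≤ᵇ w₀ then (- w₀ ≤ᵇ v) ∧ (v ≤ᵇ w₀) else (w₀ <ᵇ v) ∧ (v <ᵇ - w₀)

window₁ : ℤ → ℤ → Bool
window₁ w u = (- ∣ w ∣ℤ ≤ᵇ u) ∧ (u <ᵇ ∣ w ∣ℤ)

≤ᵇ-cong-⇔ : ∀ {i j k l} → (i ℤ.≤ j ⇔ k ℤ.≤ l) → (i ≤ᵇ j) ≡ (k ≤ᵇ l)
≤ᵇ-cong-⇔ {i} {j} {k} {l} i≤j⇔k≤l = does-⇔
  (mk⇔ (ℤ.≤⇒≤ᵇ ∘ to ∘ ℤ.≤ᵇ⇒≤) (ℤ.≤⇒≤ᵇ ∘ from ∘ ℤ.≤ᵇ⇒≤)) (T? (i ≤ᵇ j)) (T? (k ≤ᵇ l))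
  where open Equivalence i≤j⇔k≤l

0≤ᵇ-minus : ∀ i j → (+ 0 ≤ᵇ i - j) ≡ (j ≤ᵇ i)
0≤ᵇ-minus i j = ≤ᵇ-cong-⇔ (mk⇔ (ℤ.0≤i-j⇒j≤i {i} {j}) (ℤ.i≤j⇒0≤j-i {j} {i}))

0≤ᵇ-plus : ∀ i j → (+ 0 ≤ᵇ i + j) ≡ (- j ≤ᵇ i)
0≤ᵇ-plus i j = trans (cong (λ k → + 0 ≤ᵇ i + k) (sym (ℤ.neg-involutive j))) (0≤ᵇ-minus i (- j))

<ᵇ-not-≤ᵇ : ∀ i j → (i <ᵇ j) ≡ not (j ≤ᵇ i)
<ᵇ-not-≤ᵇ i j = does-⇔ (mk⇔ to from) (T? (i <ᵇ j)) (¬? (T? (j ≤ᵇ i)))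
  where
  to : T (i <ᵇ j) → ¬ T (j ≤ᵇ i)
  to i+1≤j = ℤ.<⇒≱ (ℤ.suc[i]≤j⇒i<j (subst (ℤ._≤ j) (ℤ.+-comm i (+ 1)) (ℤ.≤ᵇ⇒≤ i+1≤j))) ∘ ℤ.≤ᵇ⇒≤
  from : ¬ T (j ≤ᵇ i) → T (i <ᵇ j)
  from j≰i = ℤ.≤⇒≤ᵇ (subst (ℤ._≤ j) (ℤ.+-comm (+ 1) i) (ℤ.i<j⇒suc[i]≤j (ℤ.≰⇒> (j≰i ∘ ℤ.≤⇒≤ᵇ))))

-- sgn z unfolds to ±1 (+ 0 ≤ᵇ z). The factors + 1 and -1ℤ below are what sgn w reduces to
-- once the sign of w is known.
±1 : Bool → ℤ
±1 b = if b then + 1 else -1ℤ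

±1-difference : ∀ x y → (T y → T x) → ±1 x - ±1 y ≡ + 2 * (+ 1 * indicator (x ∧ not y))
±1-difference true  true  _   = refl
±1-difference true  false _   = refl
±1-difference false false _   = refl
±1-difference false true  y⇒x = contradiction (y⇒x tt) λ ()

±1-sum-covering : ∀ x y → (¬ T x → T y) → ±1 x + ±1 y ≡ + 2 * (+ 1 * indicator (x ∧ y))
±1-sum-covering true  true  _     = refl
±1-sum-covering true  false _     = refl
±1-sum-covering false true  _     = refl
±1-sum-covering false false ¬x⇒y = contradiction (¬x⇒y λ ()) λ ()

±1-sum-exclusive : ∀ x y → (T x → ¬ T y) → ±1 x + ±1 y ≡ + 2 * (-1ℤ * indicator (not y ∧ not x))
±1-sum-exclusive true  true  x⇒¬y = contradiction tt (x⇒¬y tt)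
±1-sum-exclusive true  false _    = refl
±1-sum-exclusive false true  _    = refl
±1-sum-exclusive false false _    = refl

sgn-window₁-pos : ∀ k u → sgn (u + + suc k) - sgn (u - + suc k) ≡ + 2 * (+ 1 * indicator (window₁ (+ suc k) u))
sgn-window₁-pos k u = begin
  ±1 (+ 0 ≤ᵇ u + p) - ±1 (+ 0 ≤ᵇ u - p)
    ≡⟨ cong₂ (λ x y → ±1 x - ±1 y) (0≤ᵇ-plus u p) (0≤ᵇ-minus u p) ⟩
  ±1 (- p ≤ᵇ u) - ±1 (p ≤ᵇ u)
    ≡⟨ ±1-difference (- p ≤ᵇ u) (p ≤ᵇ u) p≤u⇒-p≤u ⟩
  + 2 * (+ 1 * indicator ((- p ≤ᵇ u) ∧ not (p ≤ᵇ u)))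
    ≡⟨ cong (λ b → + 2 * (+ 1 * indicator ((- p ≤ᵇ u) ∧ b))) (<ᵇ-not-≤ᵇ u p) ⟨
  + 2 * (+ 1 * indicator (window₁ p u)) ∎
  where
  p = + suc k
  p≤u⇒-p≤u : T (p ≤ᵇ u) → T (- p ≤ᵇ u)
  p≤u⇒-p≤u p≤u = ℤ.≤⇒≤ᵇ (ℤ.≤-trans (ℤ.neg-≤-pos {suc k} {suc k}) (ℤ.≤ᵇ⇒≤ {p} {u} p≤u))

sgn-window₁ : ∀ w u → w ≢ + 0 → sgn (u + w) - sgn (u - w) ≡ + 2 * (sgn w * indicator (window₁ w u))
sgn-window₁ (+ zero)  u w≢0 = contradiction refl w≢0
sgn-window₁ (+ suc k) u _   = sgn-window₁-pos k u
sgn-window₁ -[1+ k ]  u _   = begin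
  sgn (u - p) - sgn (u + p)                            ≡⟨ minus-flip (sgn (u + p)) (sgn (u - p)) ⟩
  - (sgn (u + p) - sgn (u - p))                        ≡⟨ cong -_ (sgn-window₁-pos k u) ⟩
  - (+ 2 * (+ 1 * indicator (window₁ p u)))            ≡⟨ negate (indicator (window₁ p u)) ⟩
  + 2 * (-1ℤ * indicator (window₁ p u))           ∎
  where
  p = + suc k
  minus-flip : ∀ a b → b - a ≡ - (a - b)
  minus-flip = solve-∀
  negate : ∀ c → - (+ 2 * (+ 1 * c)) ≡ + 2 * (-1ℤ * c)
  negate = solve-∀

sgn-window₀ : ∀ w₀ v → sgn (w₀ + v) + sgn (w₀ - v) ≡ + 2 * (sgn w₀ * indicator (window₀ w₀ v))
sgn-window₀ w₀ v = begin
  ±1 (+ 0 ≤ᵇ w₀ + v) + ±1 (+ 0 ≤ᵇ w₀ - v)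
    ≡⟨ cong₂ (λ x y → ±1 x + ±1 y) (trans (cong (+ 0 ≤ᵇ_) (ℤ.+-comm w₀ v)) (0≤ᵇ-plus v w₀))
                                  (0≤ᵇ-minus w₀ v) ⟩
  ±1 (- w₀ ≤ᵇ v) + ±1 (v ≤ᵇ w₀)
    ≡⟨ by-sign (+ 0 ≤ᵇ w₀) refl ⟩
  + 2 * (sgn w₀ * indicator (window₀ w₀ v)) ∎
  where
  by-sign : ∀ b → (+ 0 ≤ᵇ w₀) ≡ b →
    ±1 (- w₀ ≤ᵇ v) + ±1 (v ≤ᵇ w₀)
    ≡ + 2 * (±1 b * indicator (if b then (- w₀ ≤ᵇ v) ∧ (v ≤ᵇ w₀) else (w₀ <ᵇ v) ∧ (v <ᵇ - w₀)))
  by-sign true  0≤ᵇw₀ = ±1-sum-covering (- w₀ ≤ᵇ v) (v ≤ᵇ w₀) covering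
    where
    0≤w₀ : + 0 ℤ.≤ w₀
    0≤w₀ = ℤ.≤ᵇ⇒≤ (subst T (sym 0≤ᵇw₀) tt)
    covering : ¬ T (- w₀ ≤ᵇ v) → T (v ≤ᵇ w₀)
    covering -w₀≰v =
      ℤ.≤⇒≤ᵇ (ℤ.<⇒≤ (ℤ.<-≤-trans (ℤ.≰⇒> (-w₀≰v ∘ ℤ.≤⇒≤ᵇ)) (ℤ.≤-trans (ℤ.neg-mono-≤ 0≤w₀) 0≤w₀)))
  by-sign false 0≰ᵇw₀ = trans
    (±1-sum-exclusive (- w₀ ≤ᵇ v) (v ≤ᵇ w₀) exclusive)
    (cong₂ (λ x y → + 2 * (-1ℤ * indicator (x ∧ y)))
           (sym (<ᵇ-not-≤ᵇ w₀ v)) (sym (<ᵇ-not-≤ᵇ v (- w₀))))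
    where
    w₀<0 : w₀ ℤ.< + 0
    w₀<0 = ℤ.≰⇒> (λ 0≤w₀ → subst T 0≰ᵇw₀ (ℤ.≤⇒≤ᵇ 0≤w₀))
    exclusive : T (- w₀ ≤ᵇ v) → ¬ T (v ≤ᵇ w₀)
    exclusive -w₀≤v v≤w₀ = ℤ.<-irrefl refl
      (ℤ.<-≤-trans (ℤ.<-trans w₀<0 (ℤ.neg-mono-< w₀<0)) (ℤ.≤-trans (ℤ.≤ᵇ⇒≤ -w₀≤v) (ℤ.≤ᵇ⇒≤ v≤w₀)))

sgn-square : ∀ w → sgn w * sgn w ≡ + 1
sgn-square w with + 0 ≤ᵇ w
... | true  = refl
... | false = refl

-- Dyadic rationals

toℚᵘ-/ : ∀ a d → ℚ.toℚᵘ (a ℚ./ suc d) ℚᵘ.≃ mkℚᵘ a d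
toℚᵘ-/ a d = ℚ.toℚᵘ-fromℚᵘ (mkℚᵘ a d)

/-cross : ∀ a b d e .{{_ : NonZero d}} .{{_ : NonZero e}} → a * + e ≡ b * + d → a ℚ./ d ≡ b ℚ./ e
/-cross a b (suc d) (suc e) ae≡bd =
  ℚ.toℚᵘ-injective (ℚᵘ.≃-trans (toℚᵘ-/ a d) (ℚᵘ.≃-trans (*≡* ae≡bd) (ℚᵘ.≃-sym (toℚᵘ-/ b e))))

/-+ : ∀ a b d .{{_ : NonZero d}} → a ℚ./ d ℚ.+ b ℚ./ d ≡ (a + b) ℚ./ d
/-+ a b (suc d) = ℚ.toℚᵘ-injective (ℚᵘ.≃-trans (ℚ.toℚᵘ-homo-+ (a ℚ./ suc d) (b ℚ./ suc d))
  (ℚᵘ.≃-trans (ℚᵘ.+-cong (toℚᵘ-/ a d) (toℚᵘ-/ b d)) (ℚᵘ.≃-trans (*≡* cross) (ℚᵘ.≃-sym (toℚᵘ-/ (a + b) d)))))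
  where
  D = + suc d
  cross : (a * D + b * D) * D ≡ (a + b) * + (suc d ℕ.* suc d)
  cross = trans (factor a b D) (cong ((a + b) *_) (ℤ.pos-* (suc d) (suc d)))
    where
    factor : ∀ a b D → (a * D + b * D) * D ≡ (a + b) * (D * D)
    factor = solve-∀

/-* : ∀ a b d e .{{_ : NonZero d}} .{{_ : NonZero e}} .{{_ : NonZero (d ℕ.* e)}} →
  (a ℚ./ d) ℚ.* (b ℚ./ e) ≡ (a * b) ℚ./ (d ℕ.* e)
/-* a b (suc d) (suc e) = ℚ.toℚᵘ-injective (ℚᵘ.≃-trans (ℚ.toℚᵘ-homo-* (a ℚ./ suc d) (b ℚ./ suc e))
  (ℚᵘ.≃-trans (ℚᵘ.*-cong (toℚᵘ-/ a d) (toℚᵘ-/ b e)) (ℚᵘ.≃-sym (toℚᵘ-/ (a * b) _))))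

divPow2-+ : ∀ a b k → divPow2 a k ℚ.+ divPow2 b k ≡ divPow2 (a + b) k
divPow2-+ a b k = /-+ a b (2 ^ k) {{ℕ.m^n≢0 2 k}}

divPow2-* : ∀ a b k l → divPow2 a k ℚ.* divPow2 b l ≡ divPow2 (a * b) (k ℕ.+ l)
divPow2-* a b k l = trans
  (/-* a b (2 ^ k) (2 ^ l) {{ℕ.m^n≢0 2 k}} {{ℕ.m^n≢0 2 l}} {{2^k*2^l≢0}})
  (ℚ./-cong {a * b} {2 ^ k ℕ.* 2 ^ l} {{2^k*2^l≢0}} {{ℕ.m^n≢0 2 (k ℕ.+ l)}} refl (sym (ℕ.^-distribˡ-+-* 2 k l)))
  where
  2^k*2^l≢0 = ℕ.m*n≢0 (2 ^ k) (2 ^ l) {{ℕ.m^n≢0 2 k}} {{ℕ.m^n≢0 2 l}}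

divPow2-double : ∀ a k → divPow2 (+ 2 * a) (suc k) ≡ divPow2 a k
divPow2-double a k = /-cross (+ 2 * a) a (2 ^ suc k) (2 ^ k) {{ℕ.m^n≢0 2 (suc k)}} {{ℕ.m^n≢0 2 k}}
  (trans (swap (+ 2) a (+ (2 ^ k))) (cong (a *_) (sym (ℤ.pos-* 2 (2 ^ k)))))
  where
  swap : ∀ c a p → c * a * p ≡ a * (c * p)
  swap = solve-∀

divPow2-pos-+ : ∀ x y k → divPow2 (+ x) k ℚ.+ divPow2 (+ y) k ≡ divPow2 (+ (x ℕ.+ y)) k
divPow2-pos-+ x y k = trans (divPow2-+ (+ x) (+ y) k) (cong (λ z → divPow2 z k) (sym (ℤ.pos-+ x y)))

divPow2-sign-square : ∀ w c k →
  divPow2 (sgn w * + c) k ℚ.* divPow2 (sgn w * + c) k ≡ divPow2 (+ (c ℕ.* c)) (2 ℕ.* k)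
divPow2-sign-square w c k = begin
  divPow2 (sgn w * + c) k ℚ.* divPow2 (sgn w * + c) k
    ≡⟨ divPow2-* (sgn w * + c) (sgn w * + c) k k ⟩
  divPow2 ((sgn w * + c) * (sgn w * + c)) (k ℕ.+ k)
    ≡⟨ cong₂ divPow2 square (cong (k ℕ.+_) (sym (ℕ.+-identityʳ k))) ⟩
  divPow2 (+ (c ℕ.* c)) (2 ℕ.* k) ∎
  where
  regroup : ∀ σ c → (σ * c) * (σ * c) ≡ (σ * σ) * (c * c)
  regroup = solve-∀
  square : (sgn w * + c) * (sgn w * + c) ≡ + (c ℕ.* c)
  square = begin
    (sgn w * + c) * (sgn w * + c)     ≡⟨ regroup (sgn w) (+ c) ⟩
    (sgn w * sgn w) * (+ c * + c)     ≡⟨ cong (_* (+ c * + c)) (sgn-square w) ⟩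
    + 1 * (+ c * + c)                 ≡⟨ trans (ℤ.*-identityˡ (+ c * + c)) (sym (ℤ.pos-* c c)) ⟩
    + (c ℕ.* c)                       ∎

sum-tabulate-split : ∀ {n} (T : Subset n) (q : Fin n → ℚ) x y k →
  (∀ i → lookup T i ≡ true → q i ≡ divPow2 (+ x) k) →
  (∀ i → lookup T i ≡ false → q i ≡ divPow2 (+ y) k) →
  sumℚ (List.tabulate q) ≡ divPow2 (+ (∣ T ∣ ℕ.* x)) k ℚ.+ divPow2 (+ (∣ ∁ T ∣ ℕ.* y)) k
sum-tabulate-split [] q x y k _ _ =
  sym (trans (divPow2-+ (+ 0) (+ 0) k) (ℚ.0/n≡0 (2 ^ k) {{ℕ.m^n≢0 2 k}}))
sum-tabulate-split (true ∷ T) q x y k in-T out-T = begin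
  q zero ℚ.+ sumℚ (List.tabulate (q ∘ suc))
    ≡⟨ cong₂ ℚ._+_ (in-T zero refl) (sum-tabulate-split T (q ∘ suc) x y k (in-T ∘ suc) (out-T ∘ suc)) ⟩
  divPow2 (+ x) k ℚ.+ (divPow2 (+ (∣ T ∣ ℕ.* x)) k ℚ.+ divPow2 (+ (∣ ∁ T ∣ ℕ.* y)) k)
    ≡⟨ ℚ.+-assoc (divPow2 (+ x) k) (divPow2 (+ (∣ T ∣ ℕ.* x)) k) (divPow2 (+ (∣ ∁ T ∣ ℕ.* y)) k) ⟨
  (divPow2 (+ x) k ℚ.+ divPow2 (+ (∣ T ∣ ℕ.* x)) k) ℚ.+ divPow2 (+ (∣ ∁ T ∣ ℕ.* y)) k
    ≡⟨ cong (ℚ._+ divPow2 (+ (∣ ∁ T ∣ ℕ.* y)) k) (divPow2-pos-+ x (∣ T ∣ ℕ.* x) k) ⟩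
  divPow2 (+ (suc ∣ T ∣ ℕ.* x)) k ℚ.+ divPow2 (+ (∣ ∁ T ∣ ℕ.* y)) k ∎
sum-tabulate-split (false ∷ T) q x y k in-T out-T = begin
  q zero ℚ.+ sumℚ (List.tabulate (q ∘ suc))
    ≡⟨ cong₂ ℚ._+_ (out-T zero refl) (sum-tabulate-split T (q ∘ suc) x y k (in-T ∘ suc) (out-T ∘ suc)) ⟩
  divPow2 (+ y) k ℚ.+ (divPow2 (+ (∣ T ∣ ℕ.* x)) k ℚ.+ divPow2 (+ (∣ ∁ T ∣ ℕ.* y)) k)
    ≡⟨ ℚ-+-swap (divPow2 (+ y) k) (divPow2 (+ (∣ T ∣ ℕ.* x)) k) (divPow2 (+ (∣ ∁ T ∣ ℕ.* y)) k) ⟩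
  divPow2 (+ (∣ T ∣ ℕ.* x)) k ℚ.+ (divPow2 (+ y) k ℚ.+ divPow2 (+ (∣ ∁ T ∣ ℕ.* y)) k)
    ≡⟨ cong (divPow2 (+ (∣ T ∣ ℕ.* x)) k ℚ.+_) (divPow2-pos-+ y (∣ ∁ T ∣ ℕ.* y) k) ⟩
  divPow2 (+ (∣ T ∣ ℕ.* x)) k ℚ.+ divPow2 (+ (suc ∣ ∁ T ∣ ℕ.* y)) k ∎

-- Subsets

filter-map : ∀ {A B : Set} {P : B → Set} (P? : Decidable P) (f : A → B) (xs : List A) →
  List.filter P? (map f xs) ≡ map f (List.filter (P? ∘ f) xs)
filter-map P? f List.[] = refl
filter-map P? f (x List.∷ xs) with does (P? (f x))
... | true  = cong (f x List.∷_) (filter-map P? f xs)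
... | false = filter-map P? f xs

subsets-of-size-0 : ∀ n → List.filter (λ S → ∣ S ∣ ℕ.≟ 0) (allSubsets n) ≡ ⊥ List.∷ List.[]
subsets-of-size-0 zero    = refl
subsets-of-size-0 (suc n) = begin
  List.filter P? (map (true ∷_) A ++ map (false ∷_) A)
    ≡⟨ filter-++ P? (map (true ∷_) A) (map (false ∷_) A) ⟩
  List.filter P? (map (true ∷_) A) ++ List.filter P? (map (false ∷_) A)
    ≡⟨ cong₂ _++_ (trans (filter-map P? (true ∷_) A)
                         (cong (map (true ∷_)) (filter-none (P? ∘ (true ∷_)) (universal (λ _ ()) A))))
                  (filter-map P? (false ∷_) A) ⟩
  map (false ∷_) (List.filter P? A)
    ≡⟨ cong (map (false ∷_)) (subsets-of-size-0 n) ⟩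
  ⊥ List.∷ List.[] ∎
  where
  A = allSubsets n
  P? : ∀ {m} (S : Subset m) → Dec (∣ S ∣ ≡ 0)
  P? S = ∣ S ∣ ℕ.≟ 0

subsets-of-size-1 : ∀ n → List.filter (λ S → ∣ S ∣ ℕ.≟ 1) (allSubsets n) ≡ List.tabulate ⁅_⁆
subsets-of-size-1 zero    = refl
subsets-of-size-1 (suc n) = begin
  List.filter P? (map (true ∷_) A ++ map (false ∷_) A)
    ≡⟨ filter-++ P? (map (true ∷_) A) (map (false ∷_) A) ⟩
  List.filter P? (map (true ∷_) A) ++ List.filter P? (map (false ∷_) A)
    ≡⟨ cong₂ _++_ (filter-map P? (true ∷_) A) (filter-map P? (false ∷_) A) ⟩
  map (true ∷_) (List.filter (P? ∘ (true ∷_)) A) ++ map (false ∷_) (List.filter P? A)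
    ≡⟨ cong₂ (λ xs ys → map (true ∷_) xs ++ map (false ∷_) ys)
             (trans (filter-≐ (P? ∘ (true ∷_)) (λ S → ∣ S ∣ ℕ.≟ 0) (ℕ.suc-injective , cong suc) A)
                    (subsets-of-size-0 n))
             (subsets-of-size-1 n) ⟩
  (true ∷ ⊥) List.∷ map (false ∷_) (List.tabulate ⁅_⁆)
    ≡⟨ cong ((true ∷ ⊥) List.∷_) (map-tabulate ⁅_⁆ (false ∷_)) ⟩
  List.tabulate ⁅_⁆ ∎
  where
  A = allSubsets n
  P? : ∀ {m} (S : Subset m) → Dec (∣ S ∣ ≡ 1)
  P? S = ∣ S ∣ ℕ.≟ 1

∣insertAt∣ : ∀ {n} (T : Subset n) k b → ∣ insertAt T k b ∣ ≡ ∣ b ∷ T ∣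
∣insertAt∣ T           zero    b     = refl
∣insertAt∣ (true ∷ T)  (suc k) true  = cong suc (∣insertAt∣ T k true)
∣insertAt∣ (true ∷ T)  (suc k) false = cong suc (∣insertAt∣ T k false)
∣insertAt∣ (false ∷ T) (suc k) true  = ∣insertAt∣ T k true
∣insertAt∣ (false ∷ T) (suc k) false = ∣insertAt∣ T k false

reinsert : ∀ {n} (T : Subset (suc n)) k {b} → lookup T k ≡ b → insertAt (removeAt T k) k b ≡ T
reinsert T k Tk≡b = trans (cong (insertAt (removeAt T k) k) (sym Tk≡b)) (insertAt-removeAt T k)

-- Fourier coefficients of the threshold function

fourierNumerator : ∀ {n} → (Vec ℤ n → ℤ) → Subset n → ℤ
fourierNumerator {n} f S = sumℤ (map (λ x → f x * chi S x) (cube n))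

chi-⊥ : ∀ {n} (x : Vec ℤ n) → chi ⊥ x ≡ + 1
chi-⊥ []      = refl
chi-⊥ (_ ∷ x) = chi-⊥ x

chi-⁅⁆ : ∀ {n} (k : Fin n) (x : Vec ℤ n) → chi ⁅ k ⁆ x ≡ lookup x k
chi-⁅⁆ zero    (y ∷ x) = trans (cong (y *_) (chi-⊥ x)) (ℤ.*-identityʳ y)
chi-⁅⁆ (suc k) (_ ∷ x) = chi-⁅⁆ k x

fourierNumerator-⊥ : ∀ {n} (f : Vec ℤ n → ℤ) → fourierNumerator f ⊥ ≡ cubeSum n f
fourierNumerator-⊥ {n} f = trans (sum-map-cube n (λ x → f x * chi ⊥ x))
  (cubeSum-cong n (λ x → trans (cong (f x *_) (chi-⊥ x)) (ℤ.*-identityʳ (f x))))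

fourierNumerator-⁅⁆ : ∀ {n} (f : Vec ℤ n → ℤ) k →
  fourierNumerator f ⁅ k ⁆ ≡ cubeSum n (λ x → f x * lookup x k)
fourierNumerator-⁅⁆ {n} f k = trans (sum-map-cube n (λ x → f x * chi ⁅ k ⁆ x))
  (cubeSum-cong n (λ x → cong (f x *_) (chi-⁅⁆ k x)))

-- The indicators of S₀, S₁ and S₂ in the variables a = 2i - t and b = 2j - (n - t) (with t - 1
-- in place of t for S₁, and n - t - 1 in place of n - t for S₂).
S₀-indicator S₁-indicator S₂-indicator : ℤ → ℤ → ℤ → ℤ → ℤ → ℤ
S₀-indicator w₀ w₁ w₂ a b = indicator (window₀ w₀ (w₁ * a + w₂ * b))
S₁-indicator w₀ w₁ w₂ a b = indicator (window₁ w₁ (w₀ + w₁ * a + w₂ * b))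
S₂-indicator w₀ w₁ w₂ a b = indicator (window₁ w₂ (w₀ + w₁ * a + w₂ * b))

threshold : ℤ → ℤ → ℤ → ℤ → ℤ → ℤ
threshold w₀ w₁ w₂ a b = sgn (w₀ + w₁ * a + w₂ * b)

threshold-even-part : ∀ w₀ w₁ w₂ a b →
  threshold w₀ w₁ w₂ a b + threshold w₀ w₁ w₂ (- a) (- b)
  ≡ + 2 * (sgn w₀ * S₀-indicator w₀ w₁ w₂ a b)
threshold-even-part w₀ w₁ w₂ a b = trans
  (cong₂ (λ u v → sgn u + sgn v) (regroup w₀ w₁ w₂ a b) (regroup-neg w₀ w₁ w₂ a b))
  (sgn-window₀ w₀ (w₁ * a + w₂ * b))
  where
  regroup : ∀ w₀ w₁ w₂ a b → w₀ + w₁ * a + w₂ * b ≡ w₀ + (w₁ * a + w₂ * b)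
  regroup = solve-∀
  regroup-neg : ∀ w₀ w₁ w₂ a b → w₀ + w₁ * - a + w₂ * - b ≡ w₀ - (w₁ * a + w₂ * b)
  regroup-neg = solve-∀

threshold-step₁ : ∀ w₀ w₁ w₂ → w₁ ≢ + 0 → ∀ a b →
  threshold w₀ w₁ w₂ (+ 1 + a) b - threshold w₀ w₁ w₂ (-1ℤ + a) b
  ≡ + 2 * (sgn w₁ * S₁-indicator w₀ w₁ w₂ a b)
threshold-step₁ w₀ w₁ w₂ w₁≢0 a b = trans
  (cong₂ (λ u v → sgn u - sgn v) (up w₀ w₁ w₂ a b) (down w₀ w₁ w₂ a b))
  (sgn-window₁ w₁ (w₀ + w₁ * a + w₂ * b) w₁≢0)
  where
  up : ∀ w₀ w₁ w₂ a b → w₀ + w₁ * (+ 1 + a) + w₂ * b ≡ (w₀ + w₁ * a + w₂ * b) + w₁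
  up = solve-∀
  down : ∀ w₀ w₁ w₂ a b → w₀ + w₁ * (-1ℤ + a) + w₂ * b ≡ (w₀ + w₁ * a + w₂ * b) - w₁
  down = solve-∀

threshold-step₂ : ∀ w₀ w₁ w₂ → w₂ ≢ + 0 → ∀ a b →
  threshold w₀ w₁ w₂ a (+ 1 + b) - threshold w₀ w₁ w₂ a (-1ℤ + b)
  ≡ + 2 * (sgn w₂ * S₂-indicator w₀ w₁ w₂ a b)
threshold-step₂ w₀ w₁ w₂ w₂≢0 a b = trans
  (cong₂ (λ u v → sgn u - sgn v) (up w₀ w₁ w₂ a b) (down w₀ w₁ w₂ a b))
  (sgn-window₁ w₂ (w₀ + w₁ * a + w₂ * b) w₂≢0)
  where
  up : ∀ w₀ w₁ w₂ a b → w₀ + w₁ * a + w₂ * (+ 1 + b) ≡ (w₀ + w₁ * a + w₂ * b) + w₂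
  up = solve-∀
  down : ∀ w₀ w₁ w₂ a b → w₀ + w₁ * a + w₂ * (-1ℤ + b) ≡ (w₀ + w₁ * a + w₂ * b) - w₂
  down = solve-∀

thr-numerator-⊥ : ∀ {n} w₀ w₁ w₂ (T : Subset n) →
  fourierNumerator (thr w₀ w₁ w₂ T) ⊥
  ≡ sgn w₀ * binomialSum₂ ∣ T ∣ ∣ ∁ T ∣ (S₀-indicator w₀ w₁ w₂)
thr-numerator-⊥ {n} w₀ w₁ w₂ T = begin
  fourierNumerator (thr w₀ w₁ w₂ T) ⊥ ≡⟨ fourierNumerator-⊥ (thr w₀ w₁ w₂ T) ⟩
  cubeSum n (thr w₀ w₁ w₂ T)          ≡⟨ cubeSum-blocks T g ⟩
  X                                   ≡⟨ ℤ.*-cancelˡ-≡ (+ 2) X (sgn w₀ * Y) twice ⟩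
  sgn w₀ * Y                          ∎
  where
  t = ∣ T ∣
  m = ∣ ∁ T ∣
  g = threshold w₀ w₁ w₂
  X = binomialSum₂ t m g
  Y = binomialSum₂ t m (S₀-indicator w₀ w₁ w₂)
  double : ∀ x → + 2 * x ≡ x + x
  double = solve-∀
  twice : + 2 * X ≡ + 2 * (sgn w₀ * Y)
  twice = begin
    + 2 * X                                          ≡⟨ double X ⟩
    X + X                                            ≡⟨ cong (_+_ X) (binomialSum₂-neg t m g) ⟩
    X + binomialSum₂ t m (λ a b → g (- a) (- b))     ≡⟨ binomialSum₂-+ t m g (λ a b → g (- a) (- b)) ⟨
    binomialSum₂ t m (λ a b → g a b + g (- a) (- b)) ≡⟨ binomialSum₂-cong t m (threshold-even-part w₀ w₁ w₂) ⟩
    _                                                ≡⟨ binomialSum₂-*-* t m (+ 2) (sgn w₀) (S₀-indicator w₀ w₁ w₂) ⟩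
    + 2 * (sgn w₀ * Y)                               ∎

thr-numerator-inside : ∀ {n} w₀ w₁ w₂ → w₁ ≢ + 0 → (T : Subset n) (k : Fin (suc n)) →
  fourierNumerator (thr w₀ w₁ w₂ (insertAt T k true)) ⁅ k ⁆
  ≡ + 2 * (sgn w₁ * binomialSum₂ ∣ T ∣ ∣ ∁ T ∣ (S₁-indicator w₀ w₁ w₂))
thr-numerator-inside w₀ w₁ w₂ w₁≢0 T k = begin
  _ ≡⟨ fourierNumerator-⁅⁆ (thr w₀ w₁ w₂ (insertAt T k true)) k ⟩
  _ ≡⟨ cubeSum-blocks-inside T k (threshold w₀ w₁ w₂) ⟩
  _ ≡⟨ binomialSum₂-cong (∣ T ∣) (∣ ∁ T ∣) (threshold-step₁ w₀ w₁ w₂ w₁≢0) ⟩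
  _ ≡⟨ binomialSum₂-*-* (∣ T ∣) (∣ ∁ T ∣) (+ 2) (sgn w₁) (S₁-indicator w₀ w₁ w₂) ⟩
  _ ∎

thr-numerator-outside : ∀ {n} w₀ w₁ w₂ → w₂ ≢ + 0 → (T : Subset n) (k : Fin (suc n)) →
  fourierNumerator (thr w₀ w₁ w₂ (insertAt T k false)) ⁅ k ⁆
  ≡ + 2 * (sgn w₂ * binomialSum₂ ∣ T ∣ ∣ ∁ T ∣ (S₂-indicator w₀ w₁ w₂))
thr-numerator-outside w₀ w₁ w₂ w₂≢0 T k = begin
  _ ≡⟨ fourierNumerator-⁅⁆ (thr w₀ w₁ w₂ (insertAt T k false)) k ⟩
  _ ≡⟨ cubeSum-blocks-outside T k (threshold w₀ w₁ w₂) ⟩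
  _ ≡⟨ binomialSum₂-cong (∣ T ∣) (∣ ∁ T ∣) (threshold-step₂ w₀ w₁ w₂ w₂≢0) ⟩
  _ ≡⟨ binomialSum₂-*-* (∣ T ∣) (∣ ∁ T ∣) (+ 2) (sgn w₂) (S₂-indicator w₀ w₁ w₂) ⟩
  _ ∎

-- The bracketed sums of the statement. S₁-sum is only needed for t ≥ 1 and S₂-sum for n - t ≥ 1:
-- otherwise the truncated t ∸ 1 or n ∸ t ∸ 1 occurs in a term multiplied by 0.
S₀-sum S₁-sum S₂-sum : ℤ → ℤ → ℤ → ℕ → ℕ → ℕ
S₀-sum w₀ w₁ w₂ n t = sumPairs (suc t) (suc (n ∸ t)) (inS₀ w₀ w₁ w₂ n t) (λ i j → (t C i) ℕ.* ((n ∸ t) C j))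
S₁-sum w₀ w₁ w₂ n t = sumPairs t (suc (n ∸ t)) (inS₁ w₀ w₁ w₂ n t) (λ i j → ((t ∸ 1) C i) ℕ.* ((n ∸ t) C j))
S₂-sum w₀ w₁ w₂ n t = sumPairs (suc t) (n ∸ t) (inS₂ w₀ w₁ w₂ n t) (λ i j → (t C i) ℕ.* ((n ∸ t ∸ 1) C j))

S₀-sum-binomial : ∀ w₀ w₁ w₂ n t →
  + S₀-sum w₀ w₁ w₂ n t ≡ binomialSum₂ t (n ∸ t) (S₀-indicator w₀ w₁ w₂)
S₀-sum-binomial w₀ w₁ w₂ n t = sumPairs-binomialSum₂ t (n ∸ t) (λ a b → window₀ w₀ (w₁ * a + w₂ * b))

S₁-sum-binomial : ∀ w₀ w₁ w₂ n s →
  + S₁-sum w₀ w₁ w₂ n (suc s) ≡ binomialSum₂ s (n ∸ suc s) (S₁-indicator w₀ w₁ w₂)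
S₁-sum-binomial w₀ w₁ w₂ n s = sumPairs-binomialSum₂ s (n ∸ suc s) (λ a b → window₁ w₁ (w₀ + w₁ * a + w₂ * b))

S₂-sum-binomial : ∀ w₀ w₁ w₂ n t {m} → n ∸ t ≡ suc m →
  + S₂-sum w₀ w₁ w₂ n t ≡ binomialSum₂ t m (S₂-indicator w₀ w₁ w₂)
S₂-sum-binomial w₀ w₁ w₂ n t {m} n∸t≡1+m rewrite n∸t≡1+m =
  sumPairs-binomialSum₂ t m (λ a b → window₁ w₂ (w₀ + w₁ * a + w₂ * b))

fourier² : ∀ {n} → (Vec ℤ n → ℤ) → Subset n → ℚ
fourier² f S = fourier f S ℚ.* fourier f S

fourier²-from-numerator : ∀ {n} (f : Vec ℤ (suc n) → ℤ) S w c → fourierNumerator f S ≡ + 2 * (sgn w * + c) →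
  fourier² f S ≡ divPow2 (+ (c ℕ.* c)) (2 ℕ.* suc n ∸ 2)
fourier²-from-numerator {n} f S w c numerator≡ = begin
  fourier² f S
    ≡⟨ cong (λ N → divPow2 N (suc n) ℚ.* divPow2 N (suc n)) numerator≡ ⟩
  divPow2 (+ 2 * (sgn w * + c)) (suc n) ℚ.* divPow2 (+ 2 * (sgn w * + c)) (suc n)
    ≡⟨ cong (λ z → z ℚ.* z) (divPow2-double (sgn w * + c) n) ⟩
  divPow2 (sgn w * + c) n ℚ.* divPow2 (sgn w * + c) n
    ≡⟨ divPow2-sign-square w c n ⟩
  divPow2 (+ (c ℕ.* c)) (2 ℕ.* n)
    ≡⟨ cong (λ k → divPow2 (+ (c ℕ.* c)) (k ∸ 2)) (ℕ.*-suc 2 n) ⟨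
  divPow2 (+ (c ℕ.* c)) (2 ℕ.* suc n ∸ 2) ∎

fourier²-inside : ∀ {n} w₀ w₁ w₂ → w₁ ≢ + 0 → (T : Subset (suc n)) (k : Fin (suc n)) → lookup T k ≡ true →
  fourier² (thr w₀ w₁ w₂ T) ⁅ k ⁆
  ≡ divPow2 (+ (S₁-sum w₀ w₁ w₂ (suc n) ∣ T ∣ ℕ.* S₁-sum w₀ w₁ w₂ (suc n) ∣ T ∣)) (2 ℕ.* suc n ∸ 2)
fourier²-inside {n} w₀ w₁ w₂ w₁≢0 T k Tk = subst P (reinsert T k Tk)
  (fourier²-from-numerator (thr w₀ w₁ w₂ (insertAt R k true)) ⁅ k ⁆ w₁ c
    (trans (thr-numerator-inside w₀ w₁ w₂ w₁≢0 R k) (cong (λ z → + 2 * (sgn w₁ * z)) count)))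
  where
  P : Subset (suc n) → Set
  P S = fourier² (thr w₀ w₁ w₂ S) ⁅ k ⁆
        ≡ divPow2 (+ (S₁-sum w₀ w₁ w₂ (suc n) ∣ S ∣ ℕ.* S₁-sum w₀ w₁ w₂ (suc n) ∣ S ∣)) (2 ℕ.* suc n ∸ 2)
  R = removeAt T k
  c = S₁-sum w₀ w₁ w₂ (suc n) (∣ insertAt R k true ∣)
  Y : ℕ → ℤ
  Y m = binomialSum₂ (∣ R ∣) m (S₁-indicator w₀ w₁ w₂)
  count : Y (∣ ∁ R ∣) ≡ + c
  count = begin
    Y (∣ ∁ R ∣)                               ≡⟨ cong Y (∣∁p∣≡n∸∣p∣ R) ⟩
    Y (n ∸ ∣ R ∣)                             ≡⟨ S₁-sum-binomial w₀ w₁ w₂ (suc n) (∣ R ∣) ⟨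
    + S₁-sum w₀ w₁ w₂ (suc n) (suc (∣ R ∣))   ≡⟨ cong (λ t → + S₁-sum w₀ w₁ w₂ (suc n) t) (∣insertAt∣ R k true) ⟨
    + c                                       ∎

fourier²-outside : ∀ {n} w₀ w₁ w₂ → w₂ ≢ + 0 → (T : Subset (suc n)) (k : Fin (suc n)) → lookup T k ≡ false →
  fourier² (thr w₀ w₁ w₂ T) ⁅ k ⁆
  ≡ divPow2 (+ (S₂-sum w₀ w₁ w₂ (suc n) ∣ T ∣ ℕ.* S₂-sum w₀ w₁ w₂ (suc n) ∣ T ∣)) (2 ℕ.* suc n ∸ 2)
fourier²-outside {n} w₀ w₁ w₂ w₂≢0 T k Tk = subst P (reinsert T k Tk)
  (fourier²-from-numerator (thr w₀ w₁ w₂ (insertAt R k false)) ⁅ k ⁆ w₂ c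
    (trans (thr-numerator-outside w₀ w₁ w₂ w₂≢0 R k) (cong (λ z → + 2 * (sgn w₂ * z)) count)))
  where
  P : Subset (suc n) → Set
  P S = fourier² (thr w₀ w₁ w₂ S) ⁅ k ⁆
        ≡ divPow2 (+ (S₂-sum w₀ w₁ w₂ (suc n) ∣ S ∣ ℕ.* S₂-sum w₀ w₁ w₂ (suc n) ∣ S ∣)) (2 ℕ.* suc n ∸ 2)
  R = removeAt T k
  c = S₂-sum w₀ w₁ w₂ (suc n) (∣ insertAt R k false ∣)
  1+n∸t≡1+m : suc n ∸ ∣ R ∣ ≡ suc (∣ ∁ R ∣)
  1+n∸t≡1+m = trans (ℕ.+-∸-assoc 1 (∣p∣≤n R)) (cong suc (sym (∣∁p∣≡n∸∣p∣ R)))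
  count : binomialSum₂ (∣ R ∣) (∣ ∁ R ∣) (S₂-indicator w₀ w₁ w₂) ≡ + c
  count = begin
    binomialSum₂ (∣ R ∣) (∣ ∁ R ∣) (S₂-indicator w₀ w₁ w₂)
      ≡⟨ S₂-sum-binomial w₀ w₁ w₂ (suc n) (∣ R ∣) 1+n∸t≡1+m ⟨
    + S₂-sum w₀ w₁ w₂ (suc n) (∣ R ∣)
      ≡⟨ cong (λ t → + S₂-sum w₀ w₁ w₂ (suc n) t) (∣insertAt∣ R k false) ⟨
    + c ∎

W₀-threshold : ∀ n w₀ w₁ w₂ (T : Subset n) →
  W 0 (thr w₀ w₁ w₂ T) ≡ divPow2 (+ (S₀-sum w₀ w₁ w₂ n (∣ T ∣) ℕ.* S₀-sum w₀ w₁ w₂ n (∣ T ∣))) (2 ℕ.* n)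
W₀-threshold n w₀ w₁ w₂ T = begin
  W 0 f                                              ≡⟨ cong (sumℚ ∘ map (fourier² f)) (subsets-of-size-0 n) ⟩
  fourier² f ⊥ ℚ.+ ℚ.0ℚ                              ≡⟨ ℚ.+-identityʳ (fourier² f ⊥) ⟩
  fourier² f ⊥                                       ≡⟨ cong (λ N → divPow2 N n ℚ.* divPow2 N n) numerator ⟩
  divPow2 (sgn w₀ * + c) n ℚ.* divPow2 (sgn w₀ * + c) n ≡⟨ divPow2-sign-square w₀ c n ⟩
  divPow2 (+ (c ℕ.* c)) (2 ℕ.* n)                    ∎
  where
  f = thr w₀ w₁ w₂ T
  c = S₀-sum w₀ w₁ w₂ n (∣ T ∣)
  numerator : fourierNumerator f ⊥ ≡ sgn w₀ * + c
  numerator = trans (thr-numerator-⊥ w₀ w₁ w₂ T) (cong (sgn w₀ *_) (trans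
    (cong (λ m → binomialSum₂ (∣ T ∣) m (S₀-indicator w₀ w₁ w₂)) (∣∁p∣≡n∸∣p∣ T))
    (sym (S₀-sum-binomial w₀ w₁ w₂ n (∣ T ∣)))))

W₁-threshold : ∀ n w₀ w₁ w₂ → w₁ ≢ + 0 → w₂ ≢ + 0 → (T : Subset (suc n)) →
  W 1 (thr w₀ w₁ w₂ T)
  ≡ divPow2 (+ ((∣ T ∣) ℕ.* (S₁-sum w₀ w₁ w₂ (suc n) (∣ T ∣) ℕ.* S₁-sum w₀ w₁ w₂ (suc n) (∣ T ∣)))) (2 ℕ.* suc n ∸ 2)
    ℚ.+ divPow2 (+ ((suc n ∸ (∣ T ∣)) ℕ.* (S₂-sum w₀ w₁ w₂ (suc n) (∣ T ∣) ℕ.* S₂-sum w₀ w₁ w₂ (suc n) (∣ T ∣)))) (2 ℕ.* suc n ∸ 2)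
W₁-threshold n w₀ w₁ w₂ w₁≢0 w₂≢0 T = begin
  W 1 f
    ≡⟨ cong (sumℚ ∘ map (fourier² f)) (subsets-of-size-1 (suc n)) ⟩
  sumℚ (map (fourier² f) (List.tabulate ⁅_⁆))
    ≡⟨ cong sumℚ (map-tabulate ⁅_⁆ (fourier² f)) ⟩
  sumℚ (List.tabulate (fourier² f ∘ ⁅_⁆))
    ≡⟨ sum-tabulate-split T (fourier² f ∘ ⁅_⁆) (c₁ ℕ.* c₁) (c₂ ℕ.* c₂) e
         (fourier²-inside w₀ w₁ w₂ w₁≢0 T) (fourier²-outside w₀ w₁ w₂ w₂≢0 T) ⟩
  divPow2 (+ ((∣ T ∣) ℕ.* (c₁ ℕ.* c₁))) e ℚ.+ divPow2 (+ ((∣ ∁ T ∣) ℕ.* (c₂ ℕ.* c₂))) e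
    ≡⟨ cong (λ m → divPow2 (+ ((∣ T ∣) ℕ.* (c₁ ℕ.* c₁))) e ℚ.+ divPow2 (+ (m ℕ.* (c₂ ℕ.* c₂))) e) (∣∁p∣≡n∸∣p∣ T) ⟩
  divPow2 (+ ((∣ T ∣) ℕ.* (c₁ ℕ.* c₁))) e ℚ.+ divPow2 (+ ((suc n ∸ (∣ T ∣)) ℕ.* (c₂ ℕ.* c₂))) e ∎
  where
  f = thr w₀ w₁ w₂ T
  e = 2 ℕ.* suc n ∸ 2
  c₁ = S₁-sum w₀ w₁ w₂ (suc n) (∣ T ∣)
  c₂ = S₂-sum w₀ w₁ w₂ (suc n) (∣ T ∣)

lemma2 : (n : ℕ) → 1 ≤ n → (w₀ w₁ w₂ : ℤ) → ¬ (w₁ ≡ + 0) → ¬ (w₂ ≡ + 0) →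
  (T : Subset n) → (t : ℕ) → ∣ T ∣ ≡ t → 2 ℕ.* t ≤ n →
  (W 0 (thr w₀ w₁ w₂ T)
     ≡ divPow2 (+ (sumPairs (suc t) (suc (n ∸ t)) (inS₀ w₀ w₁ w₂ n t) (λ i j → (t C i) ℕ.* ((n ∸ t) C j))
               ℕ.* sumPairs (suc t) (suc (n ∸ t)) (inS₀ w₀ w₁ w₂ n t) (λ i j → (t C i) ℕ.* ((n ∸ t) C j))))
               (2 ℕ.* n))
  × (W 1 (thr w₀ w₁ w₂ T)
     ≡ ℚ._+_
         (divPow2 (+ (t ℕ.* (sumPairs t (suc (n ∸ t)) (inS₁ w₀ w₁ w₂ n t) (λ i j → ((t ∸ 1) C i) ℕ.* ((n ∸ t) C j))
                       ℕ.* sumPairs t (suc (n ∸ t)) (inS₁ w₀ w₁ w₂ n t) (λ i j → ((t ∸ 1) C i) ℕ.* ((n ∸ t) C j)))))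
                  (2 ℕ.* n ∸ 2))
         (divPow2 (+ ((n ∸ t) ℕ.* (sumPairs (suc t) (n ∸ t) (inS₂ w₀ w₁ w₂ n t) (λ i j → (t C i) ℕ.* ((n ∸ t ∸ 1) C j))
                       ℕ.* sumPairs (suc t) (n ∸ t) (inS₂ w₀ w₁ w₂ n t) (λ i j → (t C i) ℕ.* ((n ∸ t ∸ 1) C j)))))
                  (2 ℕ.* n ∸ 2)))
lemma2 (suc n) _ w₀ w₁ w₂ w₁≢0 w₂≢0 T _ refl _ =
  W₀-threshold (suc n) w₀ w₁ w₂ T , W₁-threshold n w₀ w₁ w₂ w₁≢0 w₂≢0 T
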